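{- Let $\mathbb{S}$ be a singular genome, $\mathbb{D}$ a duplicated genome over the same families, $\check{\mathbb{D}}$ a singularization of $\mathbb{D}$, and assume $ABG(\mathbb{S},\check{\mathbb{D}})$ has no symmetric squares. Then every valid 4-cycle of $ABG(\mathbb{S},\check{\mathbb{D}})$ that shares no vertex with any 2-cycle of $ABG(\mathbb{S},\check{\mathbb{D}})$ is contained in $BG(\tau,\check{\mathbb{D}})$ for some optimal solution $\tau$ of the $\sigma_4$ disambiguation.
   Context: Genomes: genes belong to families $\mathtt{X}$ and have extremities $\mathtt{X}^h,\mathtt{X}^t$; chromosomes are linear or circular sequences of oriented genes; an adjacency is the unordered pair of neighbouring extremities of consecutive genes (circularly for circular chromosomes), a telomere is an extremity at an end of a linear chromosome. A genome is singular (each family once) or duplicated (each family twice). A singularization of a duplicated genome labels the two occurrences of each family $\mathtt{X}$ as $\mathtt{X}_a$ and $\mathtt{X}_b$. For an extremity $\gamma$ of family $\mathtt{X}$ write $\gamma_a,\gamma_b$ for the corresponding extremities of $\mathtt{X}_a,\mathtt{X}_b$; these two vertices are paralogous. Ambiguous breakpoint graph $ABG(\mathbb{S},\check{\mathbb{D}})$: vertices are all extremities of the families $\mathtt{X}_a,\mathtt{X}_b$. For each adjacency of $\check{\mathbb{D}}$ there is a $\check{\mathbb{D}}$-edge joining its extremities. For each adjacency $\gamma\beta$ of $\mathbb{S}$ there is a square of four $\mathbb{S}$-edges, split into the pair $\mathcal{E}=\{\gamma_a\beta_a,\gamma_b\beta_b\}$ and the complementary pair $\tilde{\mathcal{E}}=\{\gamma_a\beta_b,\gamma_b\beta_a\}$.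 Two $\mathbb{S}$-edges are incompatible if they lie in the same square but in different pairs. $\mathbb{S}$-telomeres are the vertices $\gamma_a,\gamma_b$ for telomeres $\gamma$ of $\mathbb{S}$; $\check{\mathbb{D}}$-telomeres are the telomeres of $\check{\mathbb{D}}$. A square is symmetric if (i) some $\check{\mathbb{D}}$-edge joins two paralogous vertices of the square, or (ii) both vertices of some paralogous pair of vertices of the square are $\check{\mathbb{D}}$-telomeres, or (iii) both vertices of some paralogous pair of vertices of the square are joined by $\check{\mathbb{D}}$-edges to $\mathbb{S}$-telomeres. A solution $\tau$ chooses for each square one of its two pairs; $BG(\tau,\check{\mathbb{D}})$ is the graph with all vertices, all $\check{\mathbb{D}}$-edges and the chosen $\mathbb{S}$-edges; its components are even cycles and paths. With $c_i$ ($p_j$) the number of cycles (paths) with $i$ ($j$) edges, the 4-score is $c_2+c_4+\frac{p_0+p_2}{2}$; the $\sigma_4$ disambiguation maximizes it, and a maximizer is an optimal solution. A valid 4-cycle is a cycle of $ABG(\mathbb{S},\check{\mathbb{D}})$ with four edges alternating between $\check{\mathbb{D}}$-edges and $\mathbb{S}$-edges and containing no two incompatible $\mathbb{S}$-edges. A 2-cycle is a $\check{\mathbb{D}}$-edge $uv$ together with an $\mathbb{S}$-edge joining $u$ and $v$. -}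

module Defs where

open import Data.Nat using (ℕ; _+_; _*_; _/_; _≤_)
open import Data.Bool using (Bool; true; false; _∧_; not; _xor_)
open import Data.Bool.Properties renaming (_≟_ to _≟B_)
open import Data.Fin using (Fin)
open import Data.Fin.Properties renaming (_≟_ to _≟F_)
open import Data.Maybe using (Maybe; just; nothing)
open import Data.Product using (Σ; _×_; _,_)
open import Data.Product.Properties using (≡-dec)
open import Data.Sum using (_⊎_)
open import Data.List using (List; []; _∷_; length; filterᵇ; cartesianProduct; allFin)
open import Relation.Nullary using (¬_; Dec)
open import Relation.Nullary.Decidable using (⌊_⌋)
open import Relation.Binary.PropositionalEquality using (_≡_; _≢_)

-- Extremity of a singular genome over families Fin n:
--   (family , isHead)   with true = X^h, false = X^t.
Ext : ℕ → Set
Ext n = Fin n × Bool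

-- Vertex of the (ambiguous) breakpoint graph = extremity of the
-- singularized duplicated genome:  (γ , copy)  with false = a, true = b.
-- So ((X , h) , false) is X_a^h, ((X , h) , true) is X_b^h, and the two
-- vertices (γ , false), (γ , true) are paralogous.
V : ℕ → Set
V n = Ext n × Bool

_≟V_ : ∀ {n} (u v : V n) → Dec (u ≡ v)
_≟V_ = ≡-dec (≡-dec _≟F_ _≟B_) _≟B_

-- Genomes, represented by their adjacencies: adj x ≡ just y iff xy is an
-- adjacency; adj x ≡ nothing iff x is a telomere.

record Genome (E : Set) : Set where
  field
    adj    : E → Maybe E
    adjSym : ∀ x y → adj x ≡ just y → adj y ≡ just x
    adjIrr : ∀ x → adj x ≢ just x
open Genome public

SingularGenome : ℕ → Set
SingularGenome n = Genome (Ext n)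

-- A singularization of a duplicated genome over families Fin n
-- (its families are X_a, X_b for X : Fin n; extremities = V n)
SingularizedGenome : ℕ → Set
SingularizedGenome n = Genome (V n)

module _ {n : ℕ} (S : SingularGenome n) (D : SingularizedGenome n) where

  DEdge : V n → V n → Set
  DEdge u v = adj D u ≡ just v

  -- some S-edge of the ABG joins u and v (an edge of the square of γβ)
  SEdge : V n → V n → Set
  SEdge (γ , _) (β , _) = adj S γ ≡ just β

  -- the S-edges uv and wx lie in the same square but in different pairs
  -- (pair 𝓔 = same copy, i.e. parity false; pair 𝓔̃ = parity true)
  Incompatible : V n → V n → V n → V n → Set
  Incompatible (γ , c) (β , d) (γ' , c') (β' , d') =
    ((γ ≡ γ' × β ≡ β') ⊎ (γ ≡ β' × β ≡ γ')) × ((c xor d) ≢ (c' xor d'))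

  -- symmetric square, condition at the paralogous pair {γ_a, γ_b}
  SymmetricAt : Ext n → Set
  SymmetricAt γ =
    DEdge (γ , false) (γ , true)
    ⊎ (adj D (γ , false) ≡ nothing × adj D (γ , true) ≡ nothing)
    ⊎ ((Σ (V n) λ u → DEdge (γ , false) u × adj S (Data.Product.proj₁ u) ≡ nothing)
       × (Σ (V n) λ u → DEdge (γ , true) u × adj S (Data.Product.proj₁ u) ≡ nothing))

  SymmetricSquare : Ext n → Ext n → Set
  SymmetricSquare γ β = SymmetricAt γ ⊎ SymmetricAt β

  NoSymmetricSquares : Set
  NoSymmetricSquares = ∀ γ β → adj S γ ≡ just β → ¬ SymmetricSquare γ β

  -- valid 4-cycle  v₁ -Ď- v₂ -S- v₃ -Ď- v₄ -S- v₁  (every alternating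
  -- 4-cycle can be written this way up to rotation)
  record ValidFourCycle (v₁ v₂ v₃ v₄ : V n) : Set where
    field
      e₁₂ : DEdge v₁ v₂
      e₂₃ : SEdge v₂ v₃
      e₃₄ : DEdge v₃ v₄
      e₄₁ : SEdge v₄ v₁
      d₁₂ : v₁ ≢ v₂
      d₁₃ : v₁ ≢ v₃
      d₁₄ : v₁ ≢ v₄
      d₂₃ : v₂ ≢ v₃
      d₂₄ : v₂ ≢ v₄
      d₃₄ : v₃ ≢ v₄
      compatible : ¬ Incompatible v₂ v₃ v₄ v₁

  OnTwoCycle : V n → Set
  OnTwoCycle v = Σ (V n) λ u → DEdge v u × SEdge v u

-- A solution chooses for each square (adjacency γβ of S) one of its pairs:
-- choice γ = false picks 𝓔 = {γ_aβ_a, γ_bβ_b}, true picks 𝓔̃ = {γ_aβ_b, γ_bβ_a}.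
record Solution {n : ℕ} (S : SingularGenome n) : Set where
  field
    choice     : Ext n → Bool
    consistent : ∀ γ β → adj S γ ≡ just β → choice γ ≡ choice β
open Solution public

module _ {n : ℕ} (S : SingularGenome n) (D : SingularizedGenome n) (τ : Solution S) where

  sτ : V n → Maybe (V n)
  sτ (γ , c) with adj S γ
  ... | nothing = nothing
  ... | just β  = just (β , (c xor choice τ γ))

  private
    dτ : V n → Maybe (V n)
    dτ = adj D

    _=ᵐ_ : Maybe (V n) → V n → Bool
    nothing =ᵐ _ = false
    just x  =ᵐ y = ⌊ x ≟V y ⌋

    isNothing : Maybe (V n) → Bool
    isNothing nothing  = true
    isNothing (just _) = false

  allV : List (V n)
  allV = cartesianProduct (cartesianProduct (allFin n) (false ∷ true ∷ [])) (false ∷ true ∷ [])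

  countV : (V n → Bool) → ℕ
  countV p = length (filterᵇ p allV)

  -- v is isolated in BG(τ, Ď)  (a path with 0 edges)
  isolatedᵇ : V n → Bool
  isolatedᵇ v = isNothing (dτ v) ∧ isNothing (sτ v)

  on2ᵇ : V n → Bool
  on2ᵇ v with dτ v
  ... | nothing = false
  ... | just w  = sτ v =ᵐ w

  on4ᵇ : V n → Bool
  on4ᵇ v with dτ v
  ... | nothing = false
  ... | just w with sτ w
  ...   | nothing = false
  ...   | just x with dτ x
  ...     | nothing = false
  ...     | just y = (sτ y =ᵐ v) ∧ not ⌊ x ≟V v ⌋

  -- v is the endpoint without S-edge of a path u -Ď- v' -S- w with 2 edges
  -- (each such path has exactly one such endpoint)
  p2endᵇ : V n → Bool
  p2endᵇ u with sτ u
  ... | just _ = false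
  ... | nothing with dτ u
  ...   | nothing = false
  ...   | just v' with sτ v'
  ...     | nothing = false
  ...     | just w = isNothing (dτ w)

  c₂ c₄ p₀ p₂ : ℕ
  c₂ = countV on2ᵇ / 2     -- each 2-cycle has 2 vertices
  c₄ = countV on4ᵇ / 4     -- each 4-cycle has 4 vertices
  p₀ = countV isolatedᵇ
  p₂ = countV p2endᵇ

  -- twice the 4-score  c₂ + c₄ + (p₀ + p₂)/2
  twiceScore : ℕ
  twiceScore = 2 * (c₂ + c₄) + p₀ + p₂

Optimal : ∀ {n} (S : SingularGenome n) (D : SingularizedGenome n) → Solution S → Set
Optimal S D τ = ∀ (τ' : Solution S) → twiceScore S D τ' ≤ twiceScore S D τ

-- Start from any optimal σ and repair it on the two squares of the cycle, choosing there the pairs that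
-- contain the cycle's S-edges; the repaired τ is still optimal. Where σ and τ differ, σ flips a square,
-- and a flipped square carries no 2-cycle of σ and no middle vertex of a 2-path of σ (this needs the
-- four extremities of the cycle distinct: no symmetric square separates e₁,e₂ and e₃,e₄, and v₁ lying on
-- no 2-cycle separates e₁,e₃). A 4-cycle of σ avoids a flipped square unless both squares are flipped;
-- then σ can only have the 4-cycles v₁v₂v₃'v₄' and v₃v₄v₁'v₂' there, while τ has the cycle itself and,
-- when σ has both, also v₁'v₂'v₃'v₄'. Isolated vertices do not depend on the solution.

module Submission where

open import Defs
open import Data.Bool using (Bool; true; false; not; _∧_; _∨_; _xor_; if_then_else_; T?)
open import Data.Bool.Properties
  using (xor-assoc; xor-same; xor-identityʳ; not-distribˡ-xor; not-involutive; ¬-not; not-¬; ∧-comm; ∧-idem; ∧-zeroʳ)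
  renaming (_≟_ to _≟B_)
open import Data.Empty using (⊥; ⊥-elim)
open import Data.Fin using (Fin; zero; suc)
open import Data.Fin.Properties using () renaming (_≟_ to _≟F_)
open import Data.List using (List; []; _∷_; length; map; filterᵇ; allFin; cartesianProduct)
open import Data.List.Extrema.Nat using (argmax; f[xs]≤f[argmax])
open import Data.List.Membership.Propositional using (_∈_)
open import Data.List.Membership.Propositional.Properties using (∈-map⁺; ∈-allFin; ∈-cartesianProduct⁺)
open import Data.List.Membership.Propositional.Properties.WithK using (unique∧set⇒bag)
open import Data.List.Properties using (length-map)
open import Data.List.Relation.Binary.BagAndSetEquality using (∼bag⇒↭)
open import Data.List.Relation.Binary.Permutation.Propositional.Properties using (filter-↭; ↭-length)
open import Data.List.Relation.Unary.All as All using ([]; _∷_)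
open import Data.List.Relation.Unary.AllPairs using ([]; _∷_)
open import Data.List.Relation.Unary.Any using (here; there)
open import Data.List.Relation.Unary.Unique.Propositional using (Unique)
open import Data.List.Relation.Unary.Unique.Propositional.Properties as Unique using (allFin⁺; cartesianProduct⁺)
open import Data.Maybe using (Maybe; just; nothing)
open import Data.Maybe.Properties using () renaming (≡-dec to ≡-decM)
open import Data.Nat using (ℕ; zero; suc; _≤_; z≤n; s≤s)
open import Data.Nat.DivMod using (/-monoˡ-≤)
open import Data.Nat.Properties using (+-mono-≤; *-monoʳ-≤; ≤-trans; ≤-reflexive; m≤n⇒m≤1+n; module ≤-Reasoning)
open import Data.Product using (Σ; Σ-syntax; _×_; _,_; proj₁; proj₂)
open import Data.Product.Properties using (≡-dec)
open import Data.Sum using (_⊎_; inj₁; inj₂)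
open import Data.Vec.Functional using (head; tail) renaming (_∷_ to _∷ᵥ_)
open import Function using (id; _∘_; mk⇔)
open import Relation.Nullary using (¬_; Dec; yes; no; does)
open import Relation.Nullary.Decidable using (dec-true; dec-false)
open import Relation.Binary.PropositionalEquality using (_≡_; _≢_; _≗_; refl; sym; trans; cong; cong₂; subst; module ≡-Reasoning)

count : ∀ {A : Set} → (A → Bool) → List A → ℕ
count p xs = length (filterᵇ p xs)

count-mono : ∀ {A : Set} {p q : A → Bool} → (∀ x → p x ≡ true → q x ≡ true) →
             ∀ xs → count p xs ≤ count q xs
count-mono p⇒q [] = z≤n
count-mono {p = p} {q} p⇒q (x ∷ xs) with p x in px | q x in qx
... | true  | true  = s≤s (count-mono p⇒q xs)
... | true  | false with () ← trans (sym (p⇒q x px)) qx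
... | false | true  = m≤n⇒m≤1+n (count-mono p⇒q xs)
... | false | false = count-mono p⇒q xs

map-filterᵇ : ∀ {A B : Set} (p : B → Bool) (f : A → B) xs →
              map f (filterᵇ (p ∘ f) xs) ≡ filterᵇ p (map f xs)
map-filterᵇ p f [] = refl
map-filterᵇ p f (x ∷ xs) with p (f x)
... | true  = cong (f x ∷_) (map-filterᵇ p f xs)
... | false = map-filterᵇ p f xs

count-∘-involution : ∀ {A : Set} (p : A → Bool) {π : A → A} → (∀ x → π (π x) ≡ x) →
                     ∀ {xs} → Unique xs → (∀ x → x ∈ xs) →
                     count (p ∘ π) xs ≡ count p xs
count-∘-involution p {π} π-involutive {xs} unique complete = begin
  length (filterᵇ (p ∘ π) xs)         ≡⟨ sym (length-map π (filterᵇ (p ∘ π) xs)) ⟩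
  length (map π (filterᵇ (p ∘ π) xs)) ≡⟨ cong length (map-filterᵇ p π xs) ⟩
  length (filterᵇ p (map π xs))       ≡⟨ ↭-length (filter-↭ (T? ∘ p) πxs↭xs) ⟩
  length (filterᵇ p xs)               ∎
  where
  open ≡-Reasoning
  π-injective : ∀ {x y} → π x ≡ π y → x ≡ y
  π-injective {x} {y} eq = trans (sym (π-involutive x)) (trans (cong π eq) (π-involutive y))
  πxs↭xs = ∼bag⇒↭ (unique∧set⇒bag (Unique.map⁺ π-injective unique) unique
             λ {x} → mk⇔ (λ _ → complete x)
                         (λ _ → subst (_∈ map π xs) (π-involutive x) (∈-map⁺ π (complete (π x)))))

module _ {A : Set} (a₀ : A) (as : List A) (as-complete : ∀ a → a ∈ as) where

  maximiser : (k : ℕ) → ((Fin k → A) → ℕ) → Fin k → A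

  bestWithHead : ∀ k → ((Fin (suc k) → A) → ℕ) → A → Fin (suc k) → A
  bestWithHead k F a = a ∷ᵥ maximiser k (F ∘ (a ∷ᵥ_))

  maximiser zero    F = λ ()
  maximiser (suc k) F = argmax F (bestWithHead k F a₀) (map (bestWithHead k F) as)

  maximiser-maximal : ∀ k (F : (Fin k → A) → ℕ) → (∀ f g → f ≗ g → F f ≤ F g) →
                      ∀ f → F f ≤ F (maximiser k F)
  maximiser-maximal zero    F F-resp f = F-resp f _ (λ ())
  maximiser-maximal (suc k) F F-resp f = begin
    F f                                  ≤⟨ F-resp f (head f ∷ᵥ tail f) (λ { zero → refl ; (suc i) → refl }) ⟩
    F (head f ∷ᵥ tail f)                 ≤⟨ maximiser-maximal k (F ∘ (head f ∷ᵥ_)) resp (tail f) ⟩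
    F (bestWithHead k F (head f))        ≤⟨ All.lookup (f[xs]≤f[argmax] {f = F} _ (map (bestWithHead k F) as))
                                                       (∈-map⁺ (bestWithHead k F) (as-complete (head f))) ⟩
    F (maximiser (suc k) F)              ∎
    where
    open ≤-Reasoning
    resp : ∀ g h → g ≗ h → F (head f ∷ᵥ g) ≤ F (head f ∷ᵥ h)
    resp g h g≗h = F-resp _ _ λ { zero → refl ; (suc i) → g≗h i }

just-functional : ∀ {A : Set} {m : Maybe A} {x y} → m ≡ just x → m ≡ just y → x ≡ y
just-functional refl refl = refl

adj-injective : ∀ {E : Set} (G : Genome E) {x y z} → adj G x ≡ just z → adj G y ≡ just z → x ≡ y
adj-injective G {x} {y} {z} xz yz = just-functional (adjSym G x z xz) (adjSym G y z yz)

xor-cancelʳ : ∀ x y → (x xor y) xor y ≡ x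
xor-cancelʳ x y = trans (xor-assoc x y y) (trans (cong (x xor_) (xor-same y)) (xor-identityʳ x))

xor-cancelˡ : ∀ x y → x xor (x xor y) ≡ y
xor-cancelˡ x y = trans (sym (xor-assoc x x y)) (cong (_xor y) (xor-same x))

≡⊎≡not : ∀ x y → x ≡ y ⊎ x ≡ not y
≡⊎≡not x y with x ≟B y
... | yes x≡y = inj₁ x≡y
... | no x≢y  = inj₂ (¬-not x≢y)

∈-bools : ∀ b → b ∈ false ∷ true ∷ []
∈-bools false = here refl
∈-bools true  = there (here refl)

_≟E_ : ∀ {n} → (γ β : Ext n) → Dec (γ ≡ β)
_≟E_ = ≡-dec _≟F_ _≟B_

copy≢not : ∀ {n} {γ : Ext n} {c} → (γ , c) ≢ (γ , not c)
copy≢not eq = not-¬ refl (cong proj₂ eq)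

module BreakpointGraph {n : ℕ} (S : SingularGenome n) (D : SingularizedGenome n) where

  s : Solution S → V n → Maybe (V n)
  s = sτ S D

  s-just : ∀ σ {γ β} c → adj S γ ≡ just β → s σ (γ , c) ≡ just (β , c xor choice σ γ)
  s-just σ {γ} c γβ with adj S γ
  s-just σ c refl | just β = refl

  s-just⁻¹ : ∀ σ {γ c w} → s σ (γ , c) ≡ just w → adj S γ ≡ just (proj₁ w)
  s-just⁻¹ σ {γ} eq with adj S γ
  s-just⁻¹ σ refl | just β = refl

  s-sym : ∀ σ {v w} → s σ v ≡ just w → s σ w ≡ just v
  s-sym σ {γ , c} {β , d} eq with adj S γ in γβ
  s-sym σ {γ , c} {β , _} refl | just β = trans (s-just σ _ (adjSym S γ β γβ))
    (cong (λ t → just (γ , t)) (trans (cong ((c xor choice σ γ) xor_) (sym (consistent σ γ β γβ)))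
                                      (xor-cancelʳ c (choice σ γ))))

  s-injective : ∀ σ {x y w} → s σ x ≡ just w → s σ y ≡ just w → x ≡ y
  s-injective σ xw yw = just-functional (s-sym σ xw) (s-sym σ yw)

  s-cong : ∀ {σ σ'} γ c → choice σ γ ≡ choice σ' γ → s σ (γ , c) ≡ s σ' (γ , c)
  s-cong γ c eq with adj S γ
  ... | nothing = refl
  ... | just β  = cong (λ t → just (β , c xor t)) eq

  s-nothing-indep : ∀ σ σ' v → s σ v ≡ nothing → s σ' v ≡ nothing
  s-nothing-indep σ σ' (γ , c) eq with adj S γ
  s-nothing-indep σ σ' (γ , c) refl | nothing = refl

  TwoCycleAt : Solution S → V n → Set
  TwoCycleAt σ v = Σ[ u ∈ V n ] adj D v ≡ just u × s σ v ≡ just u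

  record FourCycleAt (σ : Solution S) (v : V n) : Set where
    constructor fourCycle
    field
      {a b c} : V n
      v-a : adj D v ≡ just a
      a-b : s σ a ≡ just b
      b-c : adj D b ≡ just c
      c-v : s σ c ≡ just v
      b≢v : b ≢ v

  record TwoPathEnd (σ : Solution S) (u : V n) : Set where
    constructor twoPathEnd
    field
      {middle far} : V n
      u-telomere   : s σ u ≡ nothing
      u-middle     : adj D u ≡ just middle
      middle-far   : s σ middle ≡ just far
      far-telomere : adj D far ≡ nothing

  on2ᵇ-sound : ∀ σ v → on2ᵇ S D σ v ≡ true → TwoCycleAt σ v
  on2ᵇ-sound σ v eq with adj D v
  ... | just u with s σ v
  ...   | just x with x ≟V u
  ...     | yes refl = u , refl , refl

  on2ᵇ-complete : ∀ σ v → TwoCycleAt σ v → on2ᵇ S D σ v ≡ true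
  on2ᵇ-complete σ v (u , vu , sv) with adj D v
  on2ᵇ-complete σ v (u , refl , sv) | just .u with s σ v
  on2ᵇ-complete σ v (u , refl , refl) | just .u | just .u with u ≟V u
  ... | yes _  = refl
  ... | no u≢u = ⊥-elim (u≢u refl)

  on4ᵇ-sound : ∀ σ v → on4ᵇ S D σ v ≡ true → FourCycleAt σ v
  on4ᵇ-sound σ v eq with adj D v in v-a
  ... | just a with s σ a in a-b
  ...   | just b with adj D b in b-c
  ...     | just c with s σ c in c-v | b ≟V v
  ...       | just _  | yes _ with () ← trans (sym (∧-zeroʳ _)) eq
  ...       | just v' | no b≢v with v' ≟V v
  ...         | yes refl = fourCycle v-a a-b b-c c-v b≢v

  on4ᵇ-complete : ∀ σ v → FourCycleAt σ v → on4ᵇ S D σ v ≡ true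
  on4ᵇ-complete σ v (fourCycle {a} {b} {c} v-a a-b b-c c-v b≢v) with adj D v
  on4ᵇ-complete σ v (fourCycle refl a-b b-c c-v b≢v) | just a with s σ a
  on4ᵇ-complete σ v (fourCycle refl refl b-c c-v b≢v) | just a | just b with adj D b
  on4ᵇ-complete σ v (fourCycle refl refl refl c-v b≢v) | just a | just b | just c with s σ c | b ≟V v
  ... | _ | yes b≡v = ⊥-elim (b≢v b≡v)
  on4ᵇ-complete σ v (fourCycle refl refl refl refl b≢v) | just a | just b | just c | just .v | no _ with v ≟V v
  ... | yes _  = refl
  ... | no v≢v = ⊥-elim (v≢v refl)

  p2endᵇ-sound : ∀ σ u → p2endᵇ S D σ u ≡ true → TwoPathEnd σ u
  p2endᵇ-sound σ u eq with s σ u in u-tel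
  ... | nothing with adj D u in u-m
  ...   | just m with s σ m in m-f
  ...     | just f with adj D f in f-tel
  ...       | nothing = twoPathEnd u-tel u-m m-f f-tel

  p2endᵇ-complete : ∀ σ u → TwoPathEnd σ u → p2endᵇ S D σ u ≡ true
  p2endᵇ-complete σ u (twoPathEnd {m} {f} u-tel u-m m-f f-tel) with s σ u
  p2endᵇ-complete σ u (twoPathEnd {m} {f} refl u-m m-f f-tel) | nothing with adj D u
  p2endᵇ-complete σ u (twoPathEnd {m} {f} refl refl m-f f-tel) | nothing | just .m with s σ m
  p2endᵇ-complete σ u (twoPathEnd {m} {f} refl refl refl f-tel) | nothing | just .m | just .f with adj D f
  p2endᵇ-complete σ u (twoPathEnd {m} {f} refl refl refl refl) | nothing | just .m | just .f | nothing = refl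

  isolatedᵇ-indep : ∀ σ σ' v → isolatedᵇ S D σ v ≡ true → isolatedᵇ S D σ' v ≡ true
  isolatedᵇ-indep σ σ' v eq with adj D v
  ... | nothing with s σ v in sv | s σ' v in s'v
  ...   | nothing | nothing = refl
  ...   | nothing | just _ with () ← trans (sym s'v) (s-nothing-indep σ σ' v sv)

  twoCycleAt-transfer : ∀ {σ σ' v} → TwoCycleAt σ v → s σ v ≡ s σ' v → TwoCycleAt σ' v
  twoCycleAt-transfer (u , vu , sv) eq = u , vu , trans (sym eq) sv

  fourCycleAt-transfer : ∀ {σ σ' v} (C : FourCycleAt σ v) → let open FourCycleAt C in
                         s σ a ≡ s σ' a → s σ c ≡ s σ' c → FourCycleAt σ' v
  fourCycleAt-transfer (fourCycle v-a a-b b-c c-v b≢v) eqa eqc =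
    fourCycle v-a (trans (sym eqa) a-b) b-c (trans (sym eqc) c-v) b≢v

  twoPathEnd-transfer : ∀ {σ σ' u} (P : TwoPathEnd σ u) → let open TwoPathEnd P in
                        s σ middle ≡ s σ' middle → TwoPathEnd σ' u
  twoPathEnd-transfer {σ} {σ'} {u} (twoPathEnd u-tel u-m m-f f-tel) eq =
    twoPathEnd (s-nothing-indep σ σ' u u-tel) u-m (trans (sym eq) m-f) f-tel

  fourCycleAt-dPartner : ∀ {σ v x} → FourCycleAt σ v → adj D v ≡ just x → FourCycleAt σ x
  fourCycleAt-dPartner {v = v} (fourCycle {a} {b} {c} v-a a-b b-c c-v b≢v) v-x
    with refl ← just-functional v-a v-x =
    fourCycle (adjSym D v a v-a) (s-sym _ c-v) (adjSym D b c b-c) (s-sym _ a-b)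
              (λ { refl → b≢v (adj-injective D b-c v-a) })

  fourCycleAt-sPartner : ∀ {σ v x} → FourCycleAt σ v → s σ v ≡ just x → FourCycleAt σ x
  fourCycleAt-sPartner {σ} {v} (fourCycle {a} {b} {c} v-a a-b b-c c-v b≢v) v-x
    with refl ← just-functional (s-sym σ c-v) v-x =
    fourCycle (adjSym D b c b-c) (s-sym σ a-b) (adjSym D v a v-a) (s-sym σ c-v)
              (λ { refl → b≢v (adj-injective D b-c v-a) })

  fourCycleAt-closes : ∀ {σ v a b c} → FourCycleAt σ v →
                       adj D v ≡ just a → s σ a ≡ just b → s σ c ≡ just v → adj D b ≡ just c
  fourCycleAt-closes {σ} (fourCycle v-a a-b b-c c-v _) v-a' a-b' c-v'
    with refl ← just-functional v-a v-a'
    with refl ← just-functional a-b a-b'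
    with refl ← s-injective σ c-v c-v' = b-c

  allV-unique : ∀ σ → Unique (allV S D σ)
  allV-unique σ = cartesianProduct⁺ (cartesianProduct⁺ (allFin⁺ n) bools) bools
    where
    bools : Unique (false ∷ true ∷ [])
    bools = ((λ ()) ∷ []) ∷ [] ∷ []

  allV-complete : ∀ σ v → v ∈ allV S D σ
  allV-complete σ ((i , h) , c) = ∈-cartesianProduct⁺ (∈-cartesianProduct⁺ (∈-allFin i) (∈-bools h)) (∈-bools c)

  -- 4-cycles are compared up to an involution of the vertices, since repairing a solution can move them.
  twiceScore-mono : ∀ {σ σ'} (π : V n → V n) → (∀ v → π (π v) ≡ v) →
                    (∀ v → TwoCycleAt σ v → TwoCycleAt σ' v) →
                    (∀ v → FourCycleAt σ v → FourCycleAt σ' (π v)) →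
                    (∀ u → TwoPathEnd σ u → TwoPathEnd σ' u) →
                    twiceScore S D σ ≤ twiceScore S D σ'
  twiceScore-mono {σ} {σ'} π π-involutive two four path =
    +-mono-≤ (+-mono-≤ (*-monoʳ-≤ 2 (+-mono-≤ (/-monoˡ-≤ 2 count₂) (/-monoˡ-≤ 4 count₄)))
                       (count-mono (isolatedᵇ-indep σ σ') vertices))
             (count-mono (λ u → p2endᵇ-complete σ' u ∘ path u ∘ p2endᵇ-sound σ u) vertices)
    where
    vertices = allV S D σ
    count₂ = count-mono (λ v → on2ᵇ-complete σ' v ∘ two v ∘ on2ᵇ-sound σ v) vertices
    count₄ = ≤-trans (count-mono (λ v → on4ᵇ-complete σ' (π v) ∘ four v ∘ on4ᵇ-sound σ v) vertices)
                     (≤-reflexive (count-∘-involution (on4ᵇ S D σ') π-involutive (allV-unique σ) (allV-complete σ)))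

  twiceScore-cong : ∀ {σ σ'} → (∀ γ → choice σ γ ≡ choice σ' γ) → twiceScore S D σ ≤ twiceScore S D σ'
  twiceScore-cong {σ} {σ'} eq =
    twiceScore-mono id (λ _ → refl) (λ v C → twoCycleAt-transfer C (same v))
                    (λ v C → fourCycleAt-transfer C (same _) (same _)) (λ u P → twoPathEnd-transfer P (same _))
    where
    same : ∀ v → s σ v ≡ s σ' v
    same (γ , c) = s-cong γ c (eq γ)

  -- Solutions are encoded by one Boolean per extremity; a square takes the conjunction of its two extremities.
  rawChoice : (Fin n → Bool × Bool) → Ext n → Bool
  rawChoice f (i , true)  = proj₁ (f i)
  rawChoice f (i , false) = proj₂ (f i)

  solutionOf : (Fin n → Bool × Bool) → Solution S
  solutionOf f = record { choice = λ γ → squareChoice γ (adj S γ) ; consistent = consistent' }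
    where
    squareChoice : Ext n → Maybe (Ext n) → Bool
    squareChoice γ nothing  = rawChoice f γ
    squareChoice γ (just β) = rawChoice f γ ∧ rawChoice f β
    consistent' : ∀ γ β → adj S γ ≡ just β → squareChoice γ (adj S γ) ≡ squareChoice β (adj S β)
    consistent' γ β γβ rewrite γβ | adjSym S γ β γβ = ∧-comm (rawChoice f γ) (rawChoice f β)

  encode : Solution S → Fin n → Bool × Bool
  encode σ i = choice σ (i , true) , choice σ (i , false)

  rawChoice-encode : ∀ σ γ → rawChoice (encode σ) γ ≡ choice σ γ
  rawChoice-encode σ (i , true)  = refl
  rawChoice-encode σ (i , false) = refl

  solutionOf-encode : ∀ σ γ → choice σ γ ≡ choice (solutionOf (encode σ)) γ
  solutionOf-encode σ γ with adj S γ in γβ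
  ... | nothing = sym (rawChoice-encode σ γ)
  ... | just β  = sym (begin
    rawChoice (encode σ) γ ∧ rawChoice (encode σ) β ≡⟨ cong₂ _∧_ (rawChoice-encode σ γ) (rawChoice-encode σ β) ⟩
    choice σ γ ∧ choice σ β                         ≡⟨ cong (choice σ γ ∧_) (sym (consistent σ γ β γβ)) ⟩
    choice σ γ ∧ choice σ γ                         ≡⟨ ∧-idem (choice σ γ) ⟩
    choice σ γ                                      ∎)
    where open ≡-Reasoning

  rawChoice-cong : ∀ {f g} → (∀ i → f i ≡ g i) → ∀ γ → rawChoice f γ ≡ rawChoice g γ
  rawChoice-cong f≗g (i , true)  = cong proj₁ (f≗g i)
  rawChoice-cong f≗g (i , false) = cong proj₂ (f≗g i)

  solutionOf-cong : ∀ {f g} → (∀ i → f i ≡ g i) → ∀ γ → choice (solutionOf f) γ ≡ choice (solutionOf g) γ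
  solutionOf-cong f≗g γ with adj S γ
  ... | nothing = rawChoice-cong f≗g γ
  ... | just β  = cong₂ _∧_ (rawChoice-cong f≗g γ) (rawChoice-cong f≗g β)

  optimal-exists : Σ (Solution S) (Optimal S D)
  optimal-exists = solutionOf best , λ σ → ≤-trans (twiceScore-cong (solutionOf-encode σ))
                                                  (maximiser-maximal (false , false) pairs pairs-complete n score score-resp (encode σ))
    where
    pairs : List (Bool × Bool)
    pairs = cartesianProduct (false ∷ true ∷ []) (false ∷ true ∷ [])
    pairs-complete : ∀ p → p ∈ pairs
    pairs-complete (x , y) = ∈-cartesianProduct⁺ (∈-bools x) (∈-bools y)
    score : (Fin n → Bool × Bool) → ℕ
    score = twiceScore S D ∘ solutionOf
    score-resp : ∀ f g → (∀ i → f i ≡ g i) → score f ≤ score g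
    score-resp f g f≗g = twiceScore-cong (solutionOf-cong f≗g)
    best = maximiser (false , false) pairs pairs-complete n score

record ABGFourCycle {n : ℕ} (S : SingularGenome n) (D : SingularizedGenome n)
                    (e₁ e₂ e₃ e₄ : Ext n) (c₁ c₂ c₃ c₄ : Bool) : Set where
  field
    D₁₂ : adj D (e₁ , c₁) ≡ just (e₂ , c₂)
    S₂₃ : adj S e₂ ≡ just e₃
    D₃₄ : adj D (e₃ , c₃) ≡ just (e₄ , c₄)
    S₄₁ : adj S e₄ ≡ just e₁
    e₁≢e₂ : e₁ ≢ e₂
    e₁≢e₃ : e₁ ≢ e₃
    e₁≢e₄ : e₁ ≢ e₄
    e₂≢e₃ : e₂ ≢ e₃
    e₂≢e₄ : e₂ ≢ e₄
    e₃≢e₄ : e₃ ≢ e₄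

module _ {n : ℕ} {S : SingularGenome n} {D : SingularizedGenome n} where
  open BreakpointGraph S D

  rotate : ∀ {e₁ e₂ e₃ e₄ c₁ c₂ c₃ c₄} → ABGFourCycle S D e₁ e₂ e₃ e₄ c₁ c₂ c₃ c₄ →
           ABGFourCycle S D e₃ e₄ e₁ e₂ c₃ c₄ c₁ c₂
  rotate C = record
    { D₁₂ = D₃₄ ; S₂₃ = S₄₁ ; D₃₄ = D₁₂ ; S₄₁ = S₂₃
    ; e₁≢e₂ = e₃≢e₄ ; e₁≢e₃ = e₁≢e₃ ∘ sym ; e₁≢e₄ = e₂≢e₃ ∘ sym
    ; e₂≢e₃ = e₁≢e₄ ∘ sym ; e₂≢e₄ = e₂≢e₄ ∘ sym ; e₃≢e₄ = e₁≢e₂ }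
    where open ABGFourCycle C

  module Square {e₁ e₂ e₃ e₄ c₁ c₂ c₃ c₄} (C : ABGFourCycle S D e₁ e₂ e₃ e₄ c₁ c₂ c₃ c₄) where
    open ABGFourCycle C

    v₁ v₂ v₃ v₄ v₁' v₂' v₃' v₄' : V n
    v₁ = e₁ , c₁
    v₂ = e₂ , c₂
    v₃ = e₃ , c₃
    v₄ = e₄ , c₄
    v₁' = e₁ , not c₁
    v₂' = e₂ , not c₂
    v₃' = e₃ , not c₃
    v₄' = e₄ , not c₄

    D₂₁ : adj D v₂ ≡ just v₁
    D₂₁ = adjSym D v₁ v₂ D₁₂

    D₄₃ : adj D v₄ ≡ just v₃
    D₄₃ = adjSym D v₃ v₄ D₃₄

    -- The D-edges closing the 4-cycles v₁v₂v₃'v₄' and v₃v₄v₁'v₂' of a solution flipping both squares.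
    Edge₃'₄' Edge₁'₂' : Set
    Edge₃'₄' = adj D v₃' ≡ just v₄'
    Edge₁'₂' = adj D v₁' ≡ just v₂'

    -- σ keeps the S-edges v₂v₃, v₂'v₃' of the cycle's square, or flips them to v₂v₃', v₂'v₃.
    Keeps Flips : Solution S → Set
    Keeps σ = choice σ e₂ ≡ c₂ xor c₃
    Flips σ = choice σ e₂ ≡ c₂ xor not c₃

    keeps-or-flips : ∀ σ → Keeps σ ⊎ Flips σ
    keeps-or-flips σ with ≡⊎≡not (c₂ xor choice σ e₂) c₃
    ... | inj₁ eq = inj₁ (trans (sym (xor-cancelˡ c₂ _)) (cong (c₂ xor_) eq))
    ... | inj₂ eq = inj₂ (trans (sym (xor-cancelˡ c₂ _)) (cong (c₂ xor_) eq))

    keeps-flips-exclusive : ∀ {σ} → Keeps σ → Flips σ → ⊥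
    keeps-flips-exclusive keeps flips = not-¬ refl (trans (sym (xor-cancelˡ c₂ c₃))
      (trans (cong (c₂ xor_) (trans (sym keeps) flips)) (xor-cancelˡ c₂ (not c₃))))

    s-square : ∀ σ d → choice σ e₂ ≡ c₂ xor d → s σ v₂ ≡ just (e₃ , d) × s σ v₂' ≡ just (e₃ , not d)
    s-square σ d eq =
      trans (s-just σ c₂ S₂₃) (cong (λ t → just (e₃ , t)) (trans (cong (c₂ xor_) eq) (xor-cancelˡ c₂ d))) ,
      trans (s-just σ (not c₂) S₂₃)
            (cong (λ t → just (e₃ , t)) (trans (cong (not c₂ xor_) eq)
              (trans (sym (not-distribˡ-xor c₂ (c₂ xor d))) (cong not (xor-cancelˡ c₂ d)))))

    OnSquareExt : Ext n → Set
    OnSquareExt γ = γ ≡ e₂ ⊎ γ ≡ e₃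

    onSquareExt? : ∀ γ → Dec (OnSquareExt γ)
    onSquareExt? γ with γ ≟E e₂ | γ ≟E e₃
    ... | yes γ≡e₂ | _        = yes (inj₁ γ≡e₂)
    ... | no _     | yes γ≡e₃ = yes (inj₂ γ≡e₃)
    ... | no γ≢e₂  | no γ≢e₃  = no λ { (inj₁ γ≡e₂) → γ≢e₂ γ≡e₂ ; (inj₂ γ≡e₃) → γ≢e₃ γ≡e₃ }

    OnSquare : V n → Set
    OnSquare w = OnSquareExt (proj₁ w)

    data SquareVertex : V n → Set where
      at-v₂ : SquareVertex v₂
      at-v₃ : SquareVertex v₃
      at-v₂' : SquareVertex v₂'
      at-v₃' : SquareVertex v₃'

    squareVertex : ∀ w → OnSquare w → SquareVertex w
    squareVertex (e , c) (inj₁ refl) with ≡⊎≡not c c₂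
    ... | inj₁ refl = at-v₂
    ... | inj₂ refl = at-v₂'
    squareVertex (e , c) (inj₂ refl) with ≡⊎≡not c c₃
    ... | inj₁ refl = at-v₃
    ... | inj₂ refl = at-v₃'

    choice-kept : ∀ {σ τ γ} → Keeps σ → Keeps τ → OnSquareExt γ → choice σ γ ≡ choice τ γ
    choice-kept σ-keeps τ-keeps (inj₁ refl) = trans σ-keeps (sym τ-keeps)
    choice-kept {σ} {τ} σ-keeps τ-keeps (inj₂ refl) =
      trans (sym (consistent σ e₂ e₃ S₂₃)) (trans σ-keeps (trans (sym τ-keeps) (consistent τ e₂ e₃ S₂₃)))

    onSquareExt-adj : ∀ {γ β} → adj S γ ≡ just β → OnSquareExt γ → OnSquareExt β
    onSquareExt-adj γβ (inj₁ refl) = inj₂ (just-functional γβ S₂₃)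
    onSquareExt-adj γβ (inj₂ refl) = inj₁ (just-functional γβ (adjSym S e₂ e₃ S₂₃))

    s-onSquare : ∀ σ {w x} → OnSquare w → s σ w ≡ just x → OnSquare x
    s-onSquare σ on w-x = onSquareExt-adj (s-just⁻¹ σ w-x) on

    does-onSquareExt?-adj : ∀ {γ β} → adj S γ ≡ just β → does (onSquareExt? γ) ≡ does (onSquareExt? β)
    does-onSquareExt?-adj {γ} {β} γβ with onSquareExt? γ | onSquareExt? β
    ... | yes _  | yes _  = refl
    ... | no _   | no _   = refl
    ... | yes on | no off = ⊥-elim (off (onSquareExt-adj γβ on))
    ... | no off | yes on = ⊥-elim (off (onSquareExt-adj (adjSym S γ β γβ) on))

    module Kept (σ : Solution S) (keeps : Keeps σ) where
      s₂₃ : s σ v₂ ≡ just v₃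
      s₂₃ = proj₁ (s-square σ c₃ keeps)
      s₃₂ : s σ v₃ ≡ just v₂
      s₃₂ = s-sym σ s₂₃
      s₂'₃' : s σ v₂' ≡ just v₃'
      s₂'₃' = proj₂ (s-square σ c₃ keeps)
      s₃'₂' : s σ v₃' ≡ just v₂'
      s₃'₂' = s-sym σ s₂'₃'

    module Flipped (σ : Solution S) (flips : Flips σ) where
      s₂₃' : s σ v₂ ≡ just v₃'
      s₂₃' = proj₁ (s-square σ (not c₃) flips)
      s₃'₂ : s σ v₃' ≡ just v₂
      s₃'₂ = s-sym σ s₂₃'
      s₂'₃ : s σ v₂' ≡ just v₃
      s₂'₃ = trans (proj₂ (s-square σ (not c₃) flips)) (cong (λ t → just (e₃ , t)) (not-involutive c₃))
      s₃₂' : s σ v₃ ≡ just v₂'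
      s₃₂' = s-sym σ s₂'₃

      no-twoCycle : ∀ {w} → OnSquare w → ¬ TwoCycleAt σ w
      no-twoCycle {w} on (u , w-u , s-w-u) with squareVertex w on
      ... | at-v₂  = e₁≢e₃ (cong proj₁ (trans (just-functional D₂₁ w-u) (just-functional s-w-u s₂₃')))
      ... | at-v₃  = e₂≢e₄ (sym (cong proj₁ (trans (just-functional D₃₄ w-u) (just-functional s-w-u s₃₂'))))
      ... | at-v₂' with refl ← just-functional s-w-u s₂'₃ = e₂≢e₄ (cong proj₁ (just-functional (adjSym D v₂' v₃ w-u) D₃₄))
      ... | at-v₃' with refl ← just-functional s-w-u s₃'₂ = e₁≢e₃ (sym (cong proj₁ (just-functional (adjSym D v₃' v₂ w-u) D₂₁)))

      no-pathMiddle : ∀ {u} (P : TwoPathEnd σ u) → ¬ OnSquare (TwoPathEnd.middle P)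
      no-pathMiddle {u} (twoPathEnd {m} u-tel u-m m-f f-tel) on with squareVertex m on
      ... | at-v₂  with refl ← adj-injective D u-m D₁₂ with () ← trans (sym u-tel) (s-just σ c₁ (adjSym S e₄ e₁ S₄₁))
      ... | at-v₃  with refl ← adj-injective D u-m D₄₃ with () ← trans (sym u-tel) (s-just σ c₄ S₄₁)
      ... | at-v₂' with refl ← just-functional m-f s₂'₃ with () ← trans (sym f-tel) D₃₄
      ... | at-v₃' with refl ← just-functional m-f s₃'₂ with () ← trans (sym f-tel) D₂₁

  module TwoSquares {e₁ e₂ e₃ e₄ c₁ c₂ c₃ c₄} (C : ABGFourCycle S D e₁ e₂ e₃ e₄ c₁ c₂ c₃ c₄) where
    open ABGFourCycle C
    open Square C
    module Q₄₁ = Square (rotate C)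

    module FlippedKept (σ : Solution S) (flips : Flips σ) (keeps₄₁ : Q₄₁.Keeps σ) where
      open Flipped σ flips
      open Q₄₁.Kept σ keeps₄₁ renaming (s₂₃ to s₄₁; s₃₂ to s₁₄)

      no-fourCycle-v₂ : ¬ FourCycleAt σ v₂
      no-fourCycle-v₂ cycle = copy≢not (just-functional D₄₃ (fourCycleAt-closes cycle D₂₁ s₁₄ s₃'₂))

      no-fourCycle-v₃ : ¬ FourCycleAt σ v₃
      no-fourCycle-v₃ cycle = copy≢not (just-functional D₁₂ (fourCycleAt-closes cycle D₃₄ s₄₁ s₂'₃))

      no-fourCycle : ∀ {w} → OnSquare w → ¬ FourCycleAt σ w
      no-fourCycle {w} on cycle with squareVertex w on
      ... | at-v₂  = no-fourCycle-v₂ cycle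
      ... | at-v₃  = no-fourCycle-v₃ cycle
      ... | at-v₂' = no-fourCycle-v₃ (fourCycleAt-sPartner cycle s₂'₃)
      ... | at-v₃' = no-fourCycle-v₂ (fourCycleAt-sPartner cycle s₃'₂)

    module BothFlipped (σ : Solution S) (flips : Flips σ) (flips₄₁ : Q₄₁.Flips σ) where
      open Flipped σ flips
      open Q₄₁.Flipped σ flips₄₁ renaming (s₂₃' to s₄₁'; s₃'₂ to s₁'₄; s₂'₃ to s₄'₁; s₃₂' to s₁₄')

      fourCycle-v₂ : FourCycleAt σ v₂ → Edge₃'₄'
      fourCycle-v₂ cycle = adjSym D v₄' v₃' (fourCycleAt-closes cycle D₂₁ s₁₄' s₃'₂)

      fourCycle-v₃ : FourCycleAt σ v₃ → Edge₁'₂'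
      fourCycle-v₃ cycle = fourCycleAt-closes cycle D₃₄ s₄₁' s₂'₃

      fourCycle-v₃' : FourCycleAt σ v₃' → Edge₃'₄'
      fourCycle-v₃' cycle = fourCycle-v₂ (fourCycleAt-sPartner cycle s₃'₂)

      fourCycle-v₂' : FourCycleAt σ v₂' → Edge₁'₂'
      fourCycle-v₂' cycle = fourCycle-v₃ (fourCycleAt-sPartner cycle s₂'₃)

      fourCycle-dPartner : ∀ {a w} → FourCycleAt σ a → OnSquare a → adj D a ≡ just w → Q₄₁.OnSquare w
      fourCycle-dPartner {a} cycle on a-w with squareVertex a on
      ... | at-v₂  = inj₂ (cong proj₁ (just-functional a-w D₂₁))
      ... | at-v₃  = inj₁ (cong proj₁ (just-functional a-w D₃₄))
      ... | at-v₂' = inj₂ (cong proj₁ (just-functional a-w (adjSym D v₁' v₂' (fourCycle-v₂' cycle))))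
      ... | at-v₃' = inj₁ (cong proj₁ (just-functional a-w (fourCycle-v₃' cycle)))

  flipCopies : (Ext n → Bool) → V n → V n
  flipCopies P (γ , c) = γ , P γ xor c

  flipCopies-involutive : ∀ P v → flipCopies P (flipCopies P v) ≡ v
  flipCopies-involutive P (γ , c) = cong (γ ,_) (xor-cancelˡ (P γ) c)

  record Repairs {e₁ e₂ e₃ e₄ c₁ c₂ c₃ c₄} (C : ABGFourCycle S D e₁ e₂ e₃ e₄ c₁ c₂ c₃ c₄)
                 (σ τ : Solution S) : Set where
    field
      τ-keeps₂₃ : Square.Keeps C τ
      τ-keeps₄₁ : Square.Keeps (rotate C) τ
      agrees-off : ∀ γ → ¬ Square.OnSquareExt C γ → ¬ Square.OnSquareExt (rotate C) γ → choice σ γ ≡ choice τ γ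

  rotate-repairs : ∀ {e₁ e₂ e₃ e₄ c₁ c₂ c₃ c₄} {C : ABGFourCycle S D e₁ e₂ e₃ e₄ c₁ c₂ c₃ c₄} {σ τ} →
                   Repairs C σ τ → Repairs (rotate C) σ τ
  rotate-repairs R = record { τ-keeps₂₃ = τ-keeps₄₁ ; τ-keeps₄₁ = τ-keeps₂₃ ; agrees-off = λ γ off₄₁ off₂₃ → agrees-off γ off₂₃ off₄₁ }
    where open Repairs R

  module Exchange {e₁ e₂ e₃ e₄ c₁ c₂ c₃ c₄} (C : ABGFourCycle S D e₁ e₂ e₃ e₄ c₁ c₂ c₃ c₄)
                  (σ τ : Solution S) (R : Repairs C σ τ) where
    open ABGFourCycle C
    open Square C
    open TwoSquares C
    module T₄₁ = TwoSquares (rotate C)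
    open Repairs R

    s-agrees-off : ∀ {w} → ¬ OnSquare w → ¬ Q₄₁.OnSquare w → s σ w ≡ s τ w
    s-agrees-off {γ , c} off₂₃ off₄₁ = s-cong γ c (agrees-off γ off₂₃ off₄₁)

    s-agrees-or-flipped : ∀ w → s σ w ≡ s τ w ⊎ (OnSquare w × Flips σ) ⊎ (Q₄₁.OnSquare w × Q₄₁.Flips σ)
    s-agrees-or-flipped (γ , c) with onSquareExt? γ | Q₄₁.onSquareExt? γ
    ... | no off₂₃ | no off₄₁ = inj₁ (s-agrees-off off₂₃ off₄₁)
    ... | yes on | _ with keeps-or-flips σ
    ...   | inj₁ keeps = inj₁ (s-cong γ c (choice-kept {σ} {τ} keeps τ-keeps₂₃ on))
    ...   | inj₂ flips = inj₂ (inj₁ (on , flips))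
    s-agrees-or-flipped (γ , c) | no _ | yes on with Q₄₁.keeps-or-flips σ
    ...   | inj₁ keeps = inj₁ (s-cong γ c (Q₄₁.choice-kept {σ} {τ} keeps τ-keeps₄₁ on))
    ...   | inj₂ flips = inj₂ (inj₂ (on , flips))

    twoCycle-preserved : ∀ w → TwoCycleAt σ w → TwoCycleAt τ w
    twoCycle-preserved w cycle with s-agrees-or-flipped w
    ... | inj₁ same                = twoCycleAt-transfer cycle same
    ... | inj₂ (inj₁ (on , flips)) = ⊥-elim (Flipped.no-twoCycle σ flips on cycle)
    ... | inj₂ (inj₂ (on , flips)) = ⊥-elim (Q₄₁.Flipped.no-twoCycle σ flips on cycle)

    twoPathEnd-preserved : ∀ u → TwoPathEnd σ u → TwoPathEnd τ u
    twoPathEnd-preserved u path with s-agrees-or-flipped (TwoPathEnd.middle path)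
    ... | inj₁ same                = twoPathEnd-transfer path same
    ... | inj₂ (inj₁ (on , flips)) = ⊥-elim (Flipped.no-pathMiddle σ flips path on)
    ... | inj₂ (inj₂ (on , flips)) = ⊥-elim (Q₄₁.Flipped.no-pathMiddle σ flips path on)

    keeps₄₁-if-flips : Keeps σ ⊎ Q₄₁.Keeps σ → Flips σ → Q₄₁.Keeps σ
    keeps₄₁-if-flips (inj₁ keeps) flips = ⊥-elim (keeps-flips-exclusive {σ} keeps flips)
    keeps₄₁-if-flips (inj₂ keeps) _     = keeps

    keeps₂₃-if-flips₄₁ : Keeps σ ⊎ Q₄₁.Keeps σ → Q₄₁.Flips σ → Keeps σ
    keeps₂₃-if-flips₄₁ (inj₁ keeps) _     = keeps
    keeps₂₃-if-flips₄₁ (inj₂ keeps) flips = ⊥-elim (Q₄₁.keeps-flips-exclusive {σ} keeps flips)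

    fourCycle-agrees : Keeps σ ⊎ Q₄₁.Keeps σ → ∀ {x} → FourCycleAt σ x → s σ x ≡ s τ x
    fourCycle-agrees kept {x} cycle with s-agrees-or-flipped x
    ... | inj₁ same = same
    ... | inj₂ (inj₁ (on , flips)) =
      ⊥-elim (FlippedKept.no-fourCycle σ flips (keeps₄₁-if-flips kept flips) on cycle)
    ... | inj₂ (inj₂ (on , flips)) =
      ⊥-elim (T₄₁.FlippedKept.no-fourCycle σ flips (keeps₂₃-if-flips₄₁ kept flips) on cycle)

    fourCycle-preserved : Keeps σ ⊎ Q₄₁.Keeps σ → ∀ w → FourCycleAt σ w → FourCycleAt τ w
    fourCycle-preserved kept w cycle =
      fourCycleAt-transfer cycle (fourCycle-agrees kept (fourCycleAt-dPartner cycle v-a))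
                                 (fourCycle-agrees kept (fourCycleAt-sPartner cycle (s-sym σ c-v)))
      where open FourCycleAt cycle

    twiceScore-≤-kept : Keeps σ ⊎ Q₄₁.Keeps σ → twiceScore S D σ ≤ twiceScore S D τ
    twiceScore-≤-kept kept =
      twiceScore-mono id (λ _ → refl) twoCycle-preserved (fourCycle-preserved kept) twoPathEnd-preserved

    -- π swaps v₃ ↔ v₃' and v₄ ↔ v₄', taking v₁v₂v₃'v₄' to the cycle v₁v₂v₃v₄ and v₃v₄v₁'v₂' to v₃'v₄'v₁'v₂'.
    onE₃₄ : Ext n → Bool
    onE₃₄ γ = does (γ ≟E e₃) ∨ does (γ ≟E e₄)

    π : V n → V n
    π = flipCopies onE₃₄

    π-off : ∀ {γ c} → γ ≢ e₃ → γ ≢ e₄ → π (γ , c) ≡ (γ , c)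
    π-off {γ} γ≢e₃ γ≢e₄ rewrite dec-false (γ ≟E e₃) γ≢e₃ | dec-false (γ ≟E e₄) γ≢e₄ = refl

    π-v₃ : π v₃ ≡ v₃'
    π-v₃ rewrite dec-true (e₃ ≟E e₃) refl = refl

    π-v₄ : π v₄ ≡ v₄'
    π-v₄ rewrite dec-false (e₄ ≟E e₃) (e₃≢e₄ ∘ sym) | dec-true (e₄ ≟E e₄) refl = refl

    π-v₃' : π v₃' ≡ v₃
    π-v₃' = trans (cong π (sym π-v₃)) (flipCopies-involutive onE₃₄ v₃)

    π-v₄' : π v₄' ≡ v₄
    π-v₄' = trans (cong π (sym π-v₄)) (flipCopies-involutive onE₃₄ v₄)

    τ-cycle-v₁ : FourCycleAt τ v₁
    τ-cycle-v₁ = fourCycle D₁₂ s₂₃ D₃₄ s₄₁ (e₁≢e₃ ∘ sym ∘ cong proj₁)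
      where
      open Kept τ τ-keeps₂₃
      open Q₄₁.Kept τ τ-keeps₄₁ renaming (s₂₃ to s₄₁)

    τ-cycle-v₁' : Edge₃'₄' → Edge₁'₂' → FourCycleAt τ v₁'
    τ-cycle-v₁' e₃'₄' e₁'₂' = fourCycle e₁'₂' s₂'₃' e₃'₄' s₄'₁' (e₁≢e₃ ∘ sym ∘ cong proj₁)
      where
      open Kept τ τ-keeps₂₃
      open Q₄₁.Kept τ τ-keeps₄₁ renaming (s₂'₃' to s₄'₁')

    τ-cycle-v₂ : FourCycleAt τ v₂
    τ-cycle-v₂ = fourCycleAt-dPartner τ-cycle-v₁ D₁₂

    τ-cycle-v₄ : FourCycleAt τ v₄
    τ-cycle-v₄ = fourCycleAt-sPartner τ-cycle-v₁ (Q₄₁.Kept.s₃₂ τ τ-keeps₄₁)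

    τ-cycle-v₃ : FourCycleAt τ v₃
    τ-cycle-v₃ = fourCycleAt-dPartner τ-cycle-v₄ D₄₃

    module BothFlippedExchange (flips : Flips σ) (flips₄₁ : Q₄₁.Flips σ) where
      open BothFlipped σ flips flips₄₁
      module B₄₁ = T₄₁.BothFlipped σ flips₄₁ flips

      fourCycle-off : ∀ {w} → ¬ OnSquare w → ¬ Q₄₁.OnSquare w → FourCycleAt σ w → FourCycleAt τ w
      fourCycle-off {w} off₂₃ off₄₁ cycle =
        fourCycleAt-transfer cycle (s-agrees-off a-off₂₃ a-off₄₁) (s-agrees-off c-off₂₃ c-off₄₁)
        where
        open FourCycleAt cycle
        a-w : adj D a ≡ just w
        a-w = adjSym D w a v-a
        a-cycle : FourCycleAt σ a
        a-cycle = fourCycleAt-dPartner cycle v-a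
        a-off₂₃ : ¬ OnSquare a
        a-off₂₃ on = off₄₁ (fourCycle-dPartner a-cycle on a-w)
        a-off₄₁ : ¬ Q₄₁.OnSquare a
        a-off₄₁ on = off₂₃ (B₄₁.fourCycle-dPartner a-cycle on a-w)
        c-off₂₃ : ¬ OnSquare c
        c-off₂₃ on = off₂₃ (s-onSquare σ on c-v)
        c-off₄₁ : ¬ Q₄₁.OnSquare c
        c-off₄₁ on = off₄₁ (Q₄₁.s-onSquare σ on c-v)

      edge₃'₄'-from : Edge₃'₄' ⊎ ¬ Edge₁'₂' → Edge₁'₂' → Edge₃'₄'
      edge₃'₄'-from (inj₁ e₃'₄')    _     = e₃'₄'
      edge₃'₄'-from (inj₂ no-e₁'₂') e₁'₂' = ⊥-elim (no-e₁'₂' e₁'₂')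

      module _ (edge₃'₄'-or-no-edge₁'₂' : Edge₃'₄' ⊎ ¬ Edge₁'₂') where

        edge₃'₄' : Edge₁'₂' → Edge₃'₄'
        edge₃'₄' = edge₃'₄'-from edge₃'₄'-or-no-edge₁'₂'

        τ-cycle-v₁'-if : Edge₁'₂' → FourCycleAt τ v₁'
        τ-cycle-v₁'-if e₁'₂' = τ-cycle-v₁' (edge₃'₄' e₁'₂') e₁'₂'

        τ-cycle-v₂'-if : Edge₁'₂' → FourCycleAt τ v₂'
        τ-cycle-v₂'-if e₁'₂' = fourCycleAt-dPartner (τ-cycle-v₁'-if e₁'₂') e₁'₂'

        τ-cycle-v₄'-if : Edge₁'₂' → FourCycleAt τ v₄'
        τ-cycle-v₄'-if e₁'₂' = fourCycleAt-sPartner (τ-cycle-v₁'-if e₁'₂') (Q₄₁.Kept.s₃'₂' τ τ-keeps₄₁)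

        τ-cycle-v₃'-if : Edge₁'₂' → FourCycleAt τ v₃'
        τ-cycle-v₃'-if e₁'₂' = fourCycleAt-dPartner (τ-cycle-v₄'-if e₁'₂') (adjSym D v₃' v₄' (edge₃'₄' e₁'₂'))

        fourCycle-image : ∀ w → FourCycleAt σ w → FourCycleAt τ (π w)
        fourCycle-image w cycle with onSquareExt? (proj₁ w) | Q₄₁.onSquareExt? (proj₁ w)
        ... | no off₂₃ | no off₄₁ =
          subst (FourCycleAt τ) (sym (π-off (off₂₃ ∘ inj₂) (off₄₁ ∘ inj₁))) (fourCycle-off off₂₃ off₄₁ cycle)
        ... | yes on | _ with squareVertex w on
        ...   | at-v₂  = subst (FourCycleAt τ) (sym (π-off e₂≢e₃ e₂≢e₄)) τ-cycle-v₂
        ...   | at-v₃' = subst (FourCycleAt τ) (sym π-v₃') τ-cycle-v₃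
        ...   | at-v₃  = subst (FourCycleAt τ) (sym π-v₃) (τ-cycle-v₃'-if (fourCycle-v₃ cycle))
        ...   | at-v₂' = subst (FourCycleAt τ) (sym (π-off e₂≢e₃ e₂≢e₄)) (τ-cycle-v₂'-if (fourCycle-v₂' cycle))
        fourCycle-image w cycle | no _ | yes on with Q₄₁.squareVertex w on
        ...   | Q₄₁.at-v₃  = subst (FourCycleAt τ) (sym (π-off e₁≢e₃ e₁≢e₄)) τ-cycle-v₁
        ...   | Q₄₁.at-v₂' = subst (FourCycleAt τ) (sym π-v₄') τ-cycle-v₄
        ...   | Q₄₁.at-v₂  = subst (FourCycleAt τ) (sym π-v₄) (τ-cycle-v₄'-if (B₄₁.fourCycle-v₂ cycle))
        ...   | Q₄₁.at-v₃' = subst (FourCycleAt τ) (sym (π-off e₁≢e₃ e₁≢e₄)) (τ-cycle-v₁'-if (B₄₁.fourCycle-v₃' cycle))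

        twiceScore-≤-flipped : twiceScore S D σ ≤ twiceScore S D τ
        twiceScore-≤-flipped =
          twiceScore-mono π (flipCopies-involutive onE₃₄) twoCycle-preserved fourCycle-image twoPathEnd-preserved

  exchange : ∀ {e₁ e₂ e₃ e₄ c₁ c₂ c₃ c₄} (C : ABGFourCycle S D e₁ e₂ e₃ e₄ c₁ c₂ c₃ c₄) {σ τ} →
             Repairs C σ τ → twiceScore S D σ ≤ twiceScore S D τ
  exchange C {σ} {τ} R = by-cases (Square.keeps-or-flips C σ) (Square.keeps-or-flips (rotate C) σ)
    where
    module E = Exchange C σ τ R
    module E' = Exchange (rotate C) σ τ (rotate-repairs R)
    open Square C
    module Q₄₁ = Square (rotate C)
    by-cases : Keeps σ ⊎ Flips σ → Q₄₁.Keeps σ ⊎ Q₄₁.Flips σ → twiceScore S D σ ≤ twiceScore S D τ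
    by-cases (inj₁ keeps) _                = E.twiceScore-≤-kept (inj₁ keeps)
    by-cases (inj₂ _)     (inj₁ keeps₄₁)   = E.twiceScore-≤-kept (inj₂ keeps₄₁)
    by-cases (inj₂ flips) (inj₂ flips₄₁) with ≡-decM _≟V_ (adj D v₃') (just v₄')
    ... | yes e₃'₄'    = E.BothFlippedExchange.twiceScore-≤-flipped flips flips₄₁ (inj₁ e₃'₄')
    -- rotation exchanges the roles of Edge₃'₄' and Edge₁'₂'
    ... | no no-e₃'₄'  = E'.BothFlippedExchange.twiceScore-≤-flipped flips₄₁ flips (inj₂ no-e₃'₄')
  module Repair {e₁ e₂ e₃ e₄ c₁ c₂ c₃ c₄} (C : ABGFourCycle S D e₁ e₂ e₃ e₄ c₁ c₂ c₃ c₄) (σ : Solution S) where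
    open ABGFourCycle C
    open Square C
    module Q₄₁ = Square (rotate C)

    pick : Bool → Bool → Bool → Bool
    pick on₂₃ on₄₁ b = if on₂₃ then c₂ xor c₃ else if on₄₁ then c₄ xor c₁ else b

    repaired : Solution S
    repaired = record
      { choice     = λ γ → pick (does (onSquareExt? γ)) (does (Q₄₁.onSquareExt? γ)) (choice σ γ)
      ; consistent = λ γ β γβ → pick-cong (does-onSquareExt?-adj γβ) (Q₄₁.does-onSquareExt?-adj γβ) (consistent σ γ β γβ)
      }
      where
      pick-cong : ∀ {x x' y y' z z'} → x ≡ x' → y ≡ y' → z ≡ z' → pick x y z ≡ pick x' y' z'
      pick-cong refl refl refl = refl

    repaired-repairs : Repairs C σ repaired
    repaired-repairs = record { τ-keeps₂₃ = keeps ; τ-keeps₄₁ = keeps₄₁ ; agrees-off = agrees }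
      where
      keeps : Keeps repaired
      keeps rewrite dec-true (onSquareExt? e₂) (inj₁ refl) = refl
      keeps₄₁ : Q₄₁.Keeps repaired
      keeps₄₁ rewrite dec-false (onSquareExt? e₄) (λ { (inj₁ e₄≡e₂) → e₂≢e₄ (sym e₄≡e₂) ; (inj₂ e₄≡e₃) → e₃≢e₄ (sym e₄≡e₃) })
                    | dec-true (Q₄₁.onSquareExt? e₄) (inj₁ refl) = refl
      agrees : ∀ γ → ¬ OnSquareExt γ → ¬ Q₄₁.OnSquareExt γ → choice σ γ ≡ choice repaired γ
      agrees γ off₂₃ off₄₁ rewrite dec-false (onSquareExt? γ) off₂₃ | dec-false (Q₄₁.onSquareExt? γ) off₄₁ = refl

    repaired-optimal : Optimal S D σ → Optimal S D repaired
    repaired-optimal σ-optimal σ' = ≤-trans (σ-optimal σ') (exchange C repaired-repairs)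

    repaired-contains-cycle : s repaired v₂ ≡ just v₃ × s repaired v₄ ≡ just v₁
    repaired-contains-cycle = Kept.s₂₃ repaired (Repairs.τ-keeps₂₃ repaired-repairs) ,
                              Q₄₁.Kept.s₂₃ repaired (Repairs.τ-keeps₄₁ repaired-repairs)

  symmetricAt-paralogous : ∀ {γ c c'} → c ≢ c' → adj D (γ , c) ≡ just (γ , c') → SymmetricAt S D γ
  symmetricAt-paralogous {c = false} {false} c≢c' _ = ⊥-elim (c≢c' refl)
  symmetricAt-paralogous {c = false} {true}  _ e    = inj₁ e
  symmetricAt-paralogous {c = true}  {false} _ e    = inj₁ (adjSym D _ _ e)
  symmetricAt-paralogous {c = true}  {true}  c≢c' _ = ⊥-elim (c≢c' refl)

  abgFourCycle : NoSymmetricSquares S D → ∀ {e₁ e₂ e₃ e₄ c₁ c₂ c₃ c₄} →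
                 ValidFourCycle S D (e₁ , c₁) (e₂ , c₂) (e₃ , c₃) (e₄ , c₄) → ¬ OnTwoCycle S D (e₁ , c₁) →
                 ABGFourCycle S D e₁ e₂ e₃ e₄ c₁ c₂ c₃ c₄
  abgFourCycle noSym {e₁} {e₂} {e₃} {c₂ = c₂} cycle no2 = record
    { D₁₂ = e₁₂ ; S₂₃ = e₂₃ ; D₃₄ = e₃₄ ; S₄₁ = e₄₁
    ; e₁≢e₂ = λ { refl → noSym e₁ e₃ e₂₃ (inj₁ (symmetricAt-paralogous (λ { refl → d₁₂ refl }) e₁₂)) }
    ; e₁≢e₃ = e₁≢e₃
    ; e₁≢e₄ = λ { refl → adjIrr S e₁ e₄₁ }
    ; e₂≢e₃ = λ { refl → adjIrr S e₂ e₂₃ }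
    ; e₂≢e₄ = λ { refl → e₁≢e₃ (sym (just-functional e₂₃ e₄₁)) }
    ; e₃≢e₄ = λ { refl → noSym e₂ e₃ e₂₃ (inj₂ (symmetricAt-paralogous (λ { refl → d₃₄ refl }) e₃₄)) }
    }
    where
    open ValidFourCycle cycle
    e₁≢e₃ : e₁ ≢ e₃
    e₁≢e₃ refl = no2 ((e₂ , c₂) , e₁₂ , adjSym S e₂ e₁ e₂₃)

lemma2 : (n : ℕ) (S : SingularGenome n) (D : SingularizedGenome n) →
    NoSymmetricSquares S D →
    (v₁ v₂ v₃ v₄ : V n) → ValidFourCycle S D v₁ v₂ v₃ v₄ →
    ¬ OnTwoCycle S D v₁ → ¬ OnTwoCycle S D v₂ →
    ¬ OnTwoCycle S D v₃ → ¬ OnTwoCycle S D v₄ →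
    Σ (Solution S) λ τ → Optimal S D τ ×
      sτ S D τ v₂ ≡ just v₃ × sτ S D τ v₄ ≡ just v₁
lemma2 n S D noSym v₁ v₂ v₃ v₄ cycle no-twoCycle₁ _ _ _ =
  repaired , repaired-optimal σ-optimal , repaired-contains-cycle
  where
  open BreakpointGraph S D using (optimal-exists)
  σ = proj₁ optimal-exists
  σ-optimal = proj₂ optimal-exists
  open Repair (abgFourCycle noSym cycle no-twoCycle₁) σ
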